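{- Let $r > 2$. Then $C_n^{(r)} \in GR(2)$ for every integer $n \geq 3$.
   Context: A $k$-colored graph $G=(V,E)$ consists of a finite set $V$ and a function $E$ from the 2-element subsets of $V$ to $\{0,\ldots,k-1\}$. An automorphism of $G$ is a permutation of $V$ preserving $E$; $Aut(G)$ is the automorphism group as a permutation group on $V$. Permutation groups are considered up to permutation isomorphism. $GR(k)$ is the class of permutation groups $(A,V)$ with $A=Aut(G)$ for some $k$-colored graph $G$ on $V$. $C_n$ denotes the regular action of $\mathbb{Z}_n$ on $n$ points. For $(A,V)$, the parallel product $A^{(r)}$ is $A$ acting on $V\times\{1,\ldots,r\}$ by $a((v,i))=(a(v),i)$. -}

module Defs where

open import Data.Nat using (ℕ; suc; _+_)
open import Data.Nat.DivMod using (_mod_)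
open import Data.Fin using (Fin; toℕ)
open import Data.Fin.Permutation using (Permutation′; _⟨$⟩ʳ_)
open import Data.Product using (_×_; _,_; ∃)
open import Relation.Binary.PropositionalEquality using (_≡_; _≢_)

-- A k-colored graph on vertex set V: a colouring of the 2-element subsets
-- {x,y} (x ≢ y) of V by Fin k, represented as a symmetric function whose
-- values on the diagonal are irrelevant (never inspected).
record ColoredGraph (k : ℕ) (V : Set) : Set where
  field
    col  : V → V → Fin k
    sym  : ∀ x y → col x y ≡ col y x

open ColoredGraph public

IsAut : ∀ {k m} → ColoredGraph k (Fin m) → Permutation′ m → Set
IsAut G π = ∀ x y → x ≢ y → col G (π ⟨$⟩ʳ x) (π ⟨$⟩ʳ y) ≡ col G x y

rot : ∀ {n} → Fin n → Fin n → Fin n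
rot {suc n} k v = (toℕ v + toℕ k) mod (suc n)

-- the parallel product C_n^(r): Z_n acting on Fin n × Fin r
-- by k · (v , i) = (v + k , i)
parallelAct : ∀ {n r} → Fin n → Fin n × Fin r → Fin n × Fin r
parallelAct k (v , i) = (rot k v , i)

module Submission where

-- We build a simple graph on Z_n × {0, …, r-1} whose automorphisms are
-- exactly the rotations (v , i) ↦ (v + k , i); colouring its edges 1 and its
-- non-edges 0 gives the required 2-coloured graph.  Vertex (v , i) lies in
-- column v and layer i.  Layer 0 is a clique, every column is a path
-- (v , 0) — (v , 1) — ⋯ — (v , r-1), and (v , 2) is further joined to (v , 0)
-- and (v + 1 , 0).  Layer 0 is the set of vertices of degree at least five
-- and layer 2 the set of the other vertices with two neighbours in layer 0,
-- so both are invariant.  An automorphism σ therefore fixes layer 0 setwise,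
-- and an induction up the columns shows σ (v , i) = (g v , i) for a single
-- map g of Z_n; the edges (v , 2) — (v + 1 , 0) force g (v + 1) = g v + 1,
-- so g is a rotation.

open import Defs hiding (sym)
open import Data.Nat using (ℕ; zero; suc; _+_; _*_; _∸_; _<_; _≤_; _%_; s≤s; z≤n; NonZero)
import Data.Nat as ℕ
open import Data.Nat.Properties
  using ( +-comm; +-assoc; +-suc; +-cancelˡ-≡; +-mono-<; suc-injective; n<1+n; <-irrefl; <⇒≢; ≮⇒≥; _<?_
        ; 1+n≢n; 0≢1+n; m≢1+m+n; m≢1+n+m; m∸n+n≡m; m<n+o⇒m∸n<o)
open import Data.Nat.DivMod
  using (%-distribˡ-+; m%n%n≡m%n; [m+n]%n≡m%n; m<n⇒m%n≡m; m≤n⇒[n∸m]%m≡n%m)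
open import Data.Nat.GeneralisedArithmetic using (fold)
open import Data.Fin using (Fin; zero; suc; toℕ; inject₁)
open import Data.Fin.Patterns using (0F; 1F; 2F; 3F; 4F)
open import Data.Fin.Properties
  using (toℕ-injective; toℕ<n; toℕ-fromℕ<; toℕ-inject₁; pigeonhole; *↔×) renaming (_≟_ to _≟ᶠ_)
open import Data.Fin.Permutation using (Permutation′; _⟨$⟩ʳ_)
open import Data.Product using (_×_; _,_; Σ; ∃; proj₁; proj₂)
import Data.Product.Function.Dependent.Propositional as Σ
open import Data.Sum using (_⊎_; inj₁; inj₂)
import Data.Sum
open import Data.Empty using (⊥-elim)
open import Function using (_∘_; _↔_; _⇔_; Inverse; Injection; Equivalence; mk⇔)
open import Function.Properties.Inverse using (↔⇒↣)
open import Function.Definitions using (Injective)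
open import Function.Construct.Composition using (_↔-∘_)
open import Function.Construct.Identity using (↔-id)
open import Function.Construct.Symmetry using (↔-sym; ⇔-sym)
open import Function.Related.Propositional using (module EquationalReasoning)
open import Relation.Nullary using (Dec; yes; no; ¬_)
open import Relation.Nullary.Decidable using (¬?; _⊎-dec_; _×-dec_)
open import Relation.Binary.Definitions using (DecidableEquality)
open import Relation.Binary.PropositionalEquality

fold-comm : ∀ {A : Set} (f : A → A) j x → fold (f x) f j ≡ f (fold x f j)
fold-comm f zero    x = refl
fold-comm f (suc j) x = cong f (fold-comm f j x)

fold-injective : ∀ {A : Set} (f : A → A) → (∀ {x y} → f x ≡ f y → x ≡ y) →
                 ∀ j {x y} → fold x f j ≡ fold y f j → x ≡ y
fold-injective f f-inj zero    e = e
fold-injective f f-inj (suc j) e = fold-injective f f-inj j (f-inj e)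

%-absorbˡ : ∀ x y n .{{_ : NonZero n}} → (x % n + y) % n ≡ (x + y) % n
%-absorbˡ x y n = begin
  (x % n + y) % n           ≡⟨ %-distribˡ-+ (x % n) y n ⟩
  (x % n % n + y % n) % n   ≡⟨ cong (λ t → (t + y % n) % n) (m%n%n≡m%n x n) ⟩
  (x % n + y % n) % n       ≡⟨ %-distribˡ-+ x y n ⟨
  (x + y) % n               ∎
  where open ≡-Reasoning

[m+d]%n≢m : ∀ {m d n} .{{_ : NonZero n}} → m < n → 0 < d → d < n → (m + d) % n ≢ m
[m+d]%n≢m {m} {suc d} {n} m<n _ d<n eq with m + suc d <? n
... | yes m+d<n = m≢1+m+n m (begin
  m                 ≡⟨ eq ⟨
  (m + suc d) % n   ≡⟨ m<n⇒m%n≡m m+d<n ⟩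
  m + suc d         ≡⟨ +-suc m d ⟩
  suc (m + d)       ∎)
  where open ≡-Reasoning
... | no  m+d≮n = <⇒≢ d<n (+-cancelˡ-≡ m (suc d) n (begin
  m + suc d           ≡⟨ m∸n+n≡m n≤m+d ⟨
  m + suc d ∸ n + n   ≡⟨ cong (_+ n) wrapped≡m ⟩
  m + n               ∎))
  where
  open ≡-Reasoning
  n≤m+d : n ≤ m + suc d
  n≤m+d = ≮⇒≥ m+d≮n
  wrapped≡m : m + suc d ∸ n ≡ m
  wrapped≡m = begin
    m + suc d ∸ n         ≡⟨ m<n⇒m%n≡m (m<n+o⇒m∸n<o (m + suc d) n (+-mono-< m<n d<n)) ⟨
    (m + suc d ∸ n) % n   ≡⟨ m≤n⇒[n∸m]%m≡n%m n≤m+d ⟩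
    (m + suc d) % n       ≡⟨ eq ⟩
    m                     ∎

index-below : ∀ {n} (i : Fin n) {k} → toℕ i ≡ suc k → Σ (Fin n) λ j → toℕ j ≡ k
index-below (suc i) i≡1+k = inject₁ i , trans (toℕ-inject₁ i) (suc-injective i≡1+k)

module Cyclic (N′ : ℕ) where

  N : ℕ
  N = suc (suc N′)

  succ : Fin N → Fin N
  succ = rot (suc zero)

  shift : ℕ → Fin N → Fin N
  shift j v = fold v succ j

  toℕ-rot : ∀ k v → toℕ (rot k v) ≡ (toℕ v + toℕ k) % N
  toℕ-rot k v = toℕ-fromℕ< _

  toℕ-shift : ∀ j v → toℕ (shift j v) ≡ (toℕ v + j) % N
  toℕ-shift zero v = begin
    toℕ v             ≡⟨ m<n⇒m%n≡m (toℕ<n v) ⟨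
    toℕ v % N         ≡⟨ cong (_% N) (+-comm 0 (toℕ v)) ⟩
    (toℕ v + 0) % N   ∎
    where open ≡-Reasoning
  toℕ-shift (suc j) v = begin
    toℕ (succ (shift j v))        ≡⟨ toℕ-rot (suc zero) (shift j v) ⟩
    (toℕ (shift j v) + 1) % N     ≡⟨ cong (λ t → (t + 1) % N) (toℕ-shift j v) ⟩
    ((toℕ v + j) % N + 1) % N     ≡⟨ %-absorbˡ (toℕ v + j) 1 N ⟩
    (toℕ v + j + 1) % N           ≡⟨ cong (_% N) (trans (+-assoc (toℕ v) j 1) (cong (toℕ v +_) (+-comm j 1))) ⟩
    (toℕ v + suc j) % N           ∎
    where open ≡-Reasoning

  rot≡shift : ∀ k v → rot k v ≡ shift (toℕ k) v
  rot≡shift k v = toℕ-injective (trans (toℕ-rot k v) (sym (toℕ-shift (toℕ k) v)))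

  rot-comm : ∀ k v → rot k v ≡ rot v k
  rot-comm k v = toℕ-injective (begin
    toℕ (rot k v)         ≡⟨ toℕ-rot k v ⟩
    (toℕ v + toℕ k) % N   ≡⟨ cong (_% N) (+-comm (toℕ v) (toℕ k)) ⟩
    (toℕ k + toℕ v) % N   ≡⟨ toℕ-rot v k ⟨
    toℕ (rot v k)         ∎)
    where open ≡-Reasoning

  rot-zero : ∀ v → rot v zero ≡ v
  rot-zero v = toℕ-injective (trans (toℕ-rot v zero) (m<n⇒m%n≡m (toℕ<n v)))

  shift-period : ∀ v → shift N v ≡ v
  shift-period v = toℕ-injective (begin
    toℕ (shift N v)   ≡⟨ toℕ-shift N v ⟩
    (toℕ v + N) % N   ≡⟨ [m+n]%n≡m%n (toℕ v) N ⟩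
    toℕ v % N         ≡⟨ m<n⇒m%n≡m (toℕ<n v) ⟩
    toℕ v             ∎)
    where open ≡-Reasoning

  pred : Fin N → Fin N
  pred = shift (suc N′)

  succ-pred : ∀ v → succ (pred v) ≡ v
  succ-pred = shift-period

  pred-succ : ∀ v → pred (succ v) ≡ v
  pred-succ v = trans (fold-comm succ (suc N′) v) (succ-pred v)

  succ-injective : ∀ {v w} → succ v ≡ succ w → v ≡ w
  succ-injective {v} {w} e = trans (sym (pred-succ v)) (trans (cong pred e) (pred-succ w))

  rot-injective : ∀ k {v w} → rot k v ≡ rot k w → v ≡ w
  rot-injective k {v} {w} e =
    fold-injective succ succ-injective (toℕ k) (trans (sym (rot≡shift k v)) (trans e (rot≡shift k w)))

  rot-succ : ∀ k v → rot k (succ v) ≡ succ (rot k v)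
  rot-succ k v = begin
    rot k (succ v)              ≡⟨ rot≡shift k (succ v) ⟩
    shift (toℕ k) (succ v)      ≡⟨ fold-comm succ (toℕ k) v ⟩
    succ (shift (toℕ k) v)      ≡⟨ cong succ (rot≡shift k v) ⟨
    succ (rot k v)              ∎
    where open ≡-Reasoning

  shift-fixpoint-free : ∀ {j} v → 0 < j → j < N → shift j v ≢ v
  shift-fixpoint-free {j} v 0<j j<N e =
    [m+d]%n≢m (toℕ<n v) 0<j j<N (trans (sym (toℕ-shift j v)) (cong toℕ e))

  succ-no-fixpoint : ∀ v → succ v ≢ v
  succ-no-fixpoint v = shift-fixpoint-free {1} v (s≤s z≤n) (s≤s (s≤s z≤n))

  commutes-with-succ⇒rot : (g : Fin N → Fin N) → (∀ v → g (succ v) ≡ succ (g v)) →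
                           ∀ v → g v ≡ rot (g zero) v
  commutes-with-succ⇒rot g g-succ v = begin
    g v                          ≡⟨ cong g (trans (sym (rot-zero v)) (rot≡shift v zero)) ⟩
    g (shift (toℕ v) zero)       ≡⟨ g-shift (toℕ v) zero ⟩
    shift (toℕ v) (g zero)       ≡⟨ rot≡shift v (g zero) ⟨
    rot v (g zero)               ≡⟨ rot-comm v (g zero) ⟩
    rot (g zero) v               ∎
    where
    open ≡-Reasoning
    g-shift : ∀ j x → g (shift j x) ≡ shift j (g x)
    g-shift zero    x = refl
    g-shift (suc j) x = trans (g-succ (shift j x)) (cong succ (g-shift j x))

record SimpleGraph (V : Set) : Set₁ where
  field
    Adj        : V → V → Set
    adjacent?  : ∀ x y → Dec (Adj x y)
    adj-sym    : ∀ {x y} → Adj x y → Adj y x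
    adj-irrefl : ∀ {x} → ¬ Adj x x

open Inverse using (to; from; strictlyInverseˡ; strictlyInverseʳ)

to-injective : ∀ {A B : Set} (σ : A ↔ B) → Injective _≡_ _≡_ (to σ)
to-injective σ = Injection.injective (↔⇒↣ σ)

indicator : ∀ {P : Set} → Dec P → Fin 2
indicator (yes _) = suc zero
indicator (no _)  = zero

indicator-≡⇔ : ∀ {P Q : Set} (p : Dec P) (q : Dec Q) → (indicator p ≡ indicator q) ⇔ (P ⇔ Q)
indicator-≡⇔ (yes p) (yes q) = mk⇔ (λ _ → mk⇔ (λ _ → q) (λ _ → p)) (λ _ → refl)
indicator-≡⇔ (yes p) (no ¬q) = mk⇔ (λ ()) (λ P⇔Q → ⊥-elim (¬q (Equivalence.to P⇔Q p)))
indicator-≡⇔ (no ¬p) (yes q) = mk⇔ (λ ()) (λ P⇔Q → ⊥-elim (¬p (Equivalence.from P⇔Q q)))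
indicator-≡⇔ (no ¬p) (no ¬q) = mk⇔ (λ _ → mk⇔ (⊥-elim ∘ ¬p) (⊥-elim ∘ ¬q)) (λ _ → refl)

module Automorphisms {V : Set} (Γ : SimpleGraph V) where
  open SimpleGraph Γ

  IsAutomorphism : V ↔ V → Set
  IsAutomorphism σ = ∀ x y → Adj x y ⇔ Adj (to σ x) (to σ y)

  inverse-automorphism : ∀ σ → IsAutomorphism σ → IsAutomorphism (↔-sym σ)
  inverse-automorphism σ aut x y = mk⇔
    (λ a → Equivalence.from (aut (from σ x) (from σ y))
             (subst₂ Adj (sym (strictlyInverseˡ σ x)) (sym (strictlyInverseˡ σ y)) a))
    (λ a → subst₂ Adj (strictlyInverseˡ σ x) (strictlyInverseˡ σ y)
             (Equivalence.to (aut (from σ x) (from σ y)) a))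

  Invariant : (V → Set) → Set
  Invariant P = ∀ σ → IsAutomorphism σ → ∀ x → P x → P (to σ x)

  -- Invariant properties are also reflected, since inverses are automorphisms.
  invariant-reflected : ∀ {P} → Invariant P → ∀ σ → IsAutomorphism σ → ∀ x → P (to σ x) → P x
  invariant-reflected {P} inv σ aut x p =
    subst P (strictlyInverseʳ σ x) (inv (↔-sym σ) (inverse-automorphism σ aut) (to σ x) p)

  invariant-⇔ : ∀ {P Q} → (∀ x → P x ⇔ Q x) → Invariant Q → Invariant P
  invariant-⇔ P⇔Q inv σ aut x p =
    Equivalence.from (P⇔Q (to σ x)) (inv σ aut x (Equivalence.to (P⇔Q x) p))

  HasDistinctNeighbours : ℕ → V → Set
  HasDistinctNeighbours d x = Σ (Fin d → V) λ nb → Injective _≡_ _≡_ nb × (∀ t → Adj x (nb t))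

  distinct-neighbours-invariant : ∀ d → Invariant (HasDistinctNeighbours d)
  distinct-neighbours-invariant d σ aut x (nb , nb-inj , nb-adj) =
    to σ ∘ nb , nb-inj ∘ to-injective σ , λ t → Equivalence.to (aut x (nb t)) (nb-adj t)

  labelled-neighbours : ∀ {d} x (label : ∀ {y} → Adj x y → Fin d) →
    (∀ {y z} (p : Adj x y) (q : Adj x z) → label p ≡ label q → y ≡ z) →
    ¬ HasDistinctNeighbours (suc d) x
  labelled-neighbours {d} x label determined (nb , nb-inj , nb-adj)
    with s , t , s<t , same ← pigeonhole (n<1+n d) (label ∘ nb-adj) =
    <-irrefl (cong toℕ (nb-inj (determined (nb-adj s) (nb-adj t) same))) s<t

  AttachedTwiceTo : (V → Set) → V → Set
  AttachedTwiceTo S x = ¬ S x × Σ V λ y → Σ V λ z → y ≢ z × S y × S z × Adj x y × Adj x z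

  attached-invariant : ∀ {S} → Invariant S → Invariant (AttachedTwiceTo S)
  attached-invariant {S} inv σ aut x (x∉S , y , z , y≢z , y∈S , z∈S , x~y , x~z) =
    (x∉S ∘ invariant-reflected inv σ aut x) ,
    to σ y , to σ z , y≢z ∘ to-injective σ , inv σ aut y y∈S , inv σ aut z z∈S ,
    Equivalence.to (aut x y) x~y , Equivalence.to (aut x z) x~z

  colouring : ∀ {m} → Fin m ↔ V → ColoredGraph 2 (Fin m)
  colouring f = record
    { col = λ i j → indicator (adjacent? (to f i) (to f j))
    ; sym = λ i j → Equivalence.from (indicator-≡⇔ _ _) (mk⇔ adj-sym adj-sym)
    }

  conjugate : ∀ {m} → Fin m ↔ V → Permutation′ m → V ↔ V
  conjugate f π = f ↔-∘ (π ↔-∘ ↔-sym f)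

  conjugate-to : ∀ {m} (f : Fin m ↔ V) π i → to (conjugate f π) (to f i) ≡ to f (π ⟨$⟩ʳ i)
  conjugate-to f π i = cong (λ j → to f (π ⟨$⟩ʳ j)) (strictlyInverseʳ f i)

  isAut⇔isAutomorphism : ∀ {m} (f : Fin m ↔ V) π →
                         IsAut (colouring f) π ⇔ IsAutomorphism (conjugate f π)
  isAut⇔isAutomorphism f π = mk⇔ forward backward
    where
    σ = conjugate f π
    forward : IsAut (colouring f) π → IsAutomorphism σ
    forward isAut x y with from f x ≟ᶠ from f y
    ... | yes same with refl ← to-injective (↔-sym f) same =
      mk⇔ (⊥-elim ∘ adj-irrefl) (⊥-elim ∘ adj-irrefl)
    ... | no differ = ⇔-sym (subst₂ (λ a b → Adj (to σ x) (to σ y) ⇔ Adj a b)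
            (strictlyInverseˡ f x) (strictlyInverseˡ f y)
            (Equivalence.to (indicator-≡⇔ _ _) (isAut (from f x) (from f y) differ)))
    backward : IsAutomorphism σ → IsAut (colouring f) π
    backward aut i j _ = Equivalence.from (indicator-≡⇔ _ _) (⇔-sym
      (subst₂ (λ a b → Adj (to f i) (to f j) ⇔ Adj a b) (conjugate-to f π i) (conjugate-to f π j)
        (aut (to f i) (to f j))))

  conjugate-≗ : ∀ {m} (f : Fin m ↔ V) π (h : V → V) →
                (∀ x → to (conjugate f π) x ≡ h x) ⇔ (∀ i → to f (π ⟨$⟩ʳ i) ≡ h (to f i))
  conjugate-≗ f π h = mk⇔
    (λ σ≗h i → trans (sym (conjugate-to f π i)) (σ≗h (to f i)))
    (λ fπ≗hf x → trans (fπ≗hf (from f x)) (cong h (strictlyInverseˡ f x)))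

module Layers {F : Set} (_≟_ : DecidableEquality F) (succ : F → F) where

  -- the edges, each listed from one endpoint
  Link : F → ℕ → F → ℕ → Set
  Link v i w j = (i ≡ 0 × j ≡ 0 × v ≢ w)
               ⊎ (j ≡ suc i × w ≡ v)
               ⊎ (i ≡ 2 × j ≡ 0 × (w ≡ v ⊎ w ≡ succ v))

  pattern clique i≡0 j≡0 v≢w = inj₁ (i≡0 , j≡0 , v≢w)
  pattern column j≡1+i w≡v   = inj₂ (inj₁ (j≡1+i , w≡v))
  pattern twist i≡2 j≡0 w≡   = inj₂ (inj₂ (i≡2 , j≡0 , w≡))

  link? : ∀ v i w j → Dec (Link v i w j)
  link? v i w j = (i ℕ.≟ 0 ×-dec j ℕ.≟ 0 ×-dec ¬? (v ≟ w))
            ⊎-dec (j ℕ.≟ suc i ×-dec w ≟ v)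
            ⊎-dec (i ℕ.≟ 2 ×-dec j ℕ.≟ 0 ×-dec (w ≟ v ⊎-dec w ≟ succ v))

  link-irrefl : ∀ {v i} → ¬ Link v i v i
  link-irrefl (clique _ _ v≢v)      = v≢v refl
  link-irrefl (column i≡1+i _)      = 1+n≢n (sym i≡1+i)
  link-irrefl (twist refl () _)

  Adjacent : F → ℕ → F → ℕ → Set
  Adjacent v i w j = Link v i w j ⊎ Link w j v i

  data UpperNeighbour (u : F) (i : ℕ) (w : F) (j : ℕ) : Set where
    below : w ≡ u → j ≡ i     → UpperNeighbour u i w j
    above : w ≡ u → j ≡ 2 + i → UpperNeighbour u i w j
    base  : i ≡ 1 → j ≡ 0 → w ≡ u ⊎ w ≡ succ u → UpperNeighbour u i w j

  upper-neighbour : ∀ {u i w j} → Adjacent u (suc i) w j → UpperNeighbour u i w j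
  upper-neighbour (inj₁ (clique () _ _))
  upper-neighbour (inj₁ (column j≡2+i w≡u))  = above w≡u j≡2+i
  upper-neighbour (inj₁ (twist refl j≡0 w≡)) = base refl j≡0 w≡
  upper-neighbour (inj₂ (clique _ () _))
  upper-neighbour (inj₂ (column refl refl))  = below refl refl
  upper-neighbour (inj₂ (twist _ () _))

  module Relabel (g : F → F) (g-injective : Injective _≡_ _≡_ g)
                 (g-succ : ∀ v → g (succ v) ≡ succ (g v)) where

    link-relabel : ∀ {v i w j} → Link v i w j → Link (g v) i (g w) j
    link-relabel (clique i≡0 j≡0 v≢w)       = clique i≡0 j≡0 (v≢w ∘ g-injective)
    link-relabel (column j≡1+i refl)        = column j≡1+i refl
    link-relabel (twist i≡2 j≡0 (inj₁ refl)) = twist i≡2 j≡0 (inj₁ refl)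
    link-relabel (twist i≡2 j≡0 (inj₂ refl)) = twist i≡2 j≡0 (inj₂ (g-succ _))

    link-unrelabel : ∀ {v i w j} → Link (g v) i (g w) j → Link v i w j
    link-unrelabel (clique i≡0 j≡0 gv≢gw)  = clique i≡0 j≡0 (gv≢gw ∘ cong g)
    link-unrelabel (column j≡1+i gw≡gv)    = column j≡1+i (g-injective gw≡gv)
    link-unrelabel (twist i≡2 j≡0 (inj₁ e)) = twist i≡2 j≡0 (inj₁ (g-injective e))
    link-unrelabel {v} (twist i≡2 j≡0 (inj₂ e)) =
      twist i≡2 j≡0 (inj₂ (g-injective (trans e (sym (g-succ v)))))

    adjacent-relabel : ∀ v i w j → Adjacent v i w j ⇔ Adjacent (g v) i (g w) j
    adjacent-relabel v i w j = mk⇔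
      (Data.Sum.map link-relabel link-relabel) (Data.Sum.map link-unrelabel link-unrelabel)

module Construction (a b : ℕ) where
  open Cyclic (suc a)
  open Layers _≟ᶠ_ succ

  R : ℕ
  R = suc (suc (suc b))

  V : Set
  V = Fin N × Fin R

  layer : V → ℕ
  layer (_ , i) = toℕ i

  Adj : V → V → Set
  Adj (v , i) (w , j) = Adjacent v (toℕ i) w (toℕ j)

  Γ : SimpleGraph V
  Γ = record
    { Adj        = Adj
    ; adjacent?  = λ (v , i) (w , j) → link? v (toℕ i) w (toℕ j) ⊎-dec link? w (toℕ j) v (toℕ i)
    ; adj-sym    = Data.Sum.swap
    ; adj-irrefl = Data.Sum.[ link-irrefl , link-irrefl ]
    }

  open Automorphisms Γ

  vertex-≡ : ∀ {x y : V} → proj₁ x ≡ proj₁ y → layer x ≡ layer y → x ≡ y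
  vertex-≡ refl e = cong (_ ,_) (toℕ-injective e)

  neighbour-of-upper : ∀ {x y k} → layer x ≡ suc k → Adj x y →
                       UpperNeighbour (proj₁ x) k (proj₁ y) (layer y)
  neighbour-of-upper {x} {y} x∈1+k x~y =
    upper-neighbour (subst (λ l → Adjacent (proj₁ x) l (proj₁ y) (layer y)) x∈1+k x~y)

  rotation-automorphism : ∀ k x y → Adj x y ⇔ Adj (parallelAct k x) (parallelAct k y)
  rotation-automorphism k (v , i) (w , j) =
    Relabel.adjacent-relabel (rot k) (rot-injective k) (rot-succ k) v (toℕ i) w (toℕ j)

  base-degree : ∀ v → HasDistinctNeighbours 5 (v , 0F)
  base-degree v = nb , nb-injective , nb-adjacent
    where
    nb : Fin 5 → V
    nb 0F = succ v , 0F
    nb 1F = succ (succ v) , 0F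
    nb 2F = v , 1F
    nb 3F = v , 2F
    nb 4F = pred v , 2F
    v≢sv : v ≢ succ v
    v≢sv = succ-no-fixpoint v ∘ sym
    v≢ssv : v ≢ succ (succ v)
    v≢ssv = shift-fixpoint-free {2} v (s≤s z≤n) (s≤s (s≤s (s≤s z≤n))) ∘ sym
    v≢pv : v ≢ pred v
    v≢pv v≡pv = v≢sv (sym (trans (cong succ v≡pv) (succ-pred v)))
    nb-injective : Injective _≡_ _≡_ nb
    nb-injective {0F} {0F} _  = refl
    nb-injective {0F} {1F} e  = ⊥-elim (v≢sv (succ-injective (cong proj₁ e)))
    nb-injective {0F} {2F} ()
    nb-injective {0F} {3F} ()
    nb-injective {0F} {4F} ()
    nb-injective {1F} {0F} e  = ⊥-elim (v≢sv (succ-injective (sym (cong proj₁ e))))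
    nb-injective {1F} {1F} _  = refl
    nb-injective {1F} {2F} ()
    nb-injective {1F} {3F} ()
    nb-injective {1F} {4F} ()
    nb-injective {2F} {0F} ()
    nb-injective {2F} {1F} ()
    nb-injective {2F} {2F} _  = refl
    nb-injective {2F} {3F} ()
    nb-injective {2F} {4F} ()
    nb-injective {3F} {0F} ()
    nb-injective {3F} {1F} ()
    nb-injective {3F} {2F} ()
    nb-injective {3F} {3F} _  = refl
    nb-injective {3F} {4F} e  = ⊥-elim (v≢pv (cong proj₁ e))
    nb-injective {4F} {0F} ()
    nb-injective {4F} {1F} ()
    nb-injective {4F} {2F} ()
    nb-injective {4F} {3F} e  = ⊥-elim (v≢pv (sym (cong proj₁ e)))
    nb-injective {4F} {4F} _  = refl
    nb-adjacent : ∀ t → Adj (v , 0F) (nb t)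
    nb-adjacent 0F = inj₁ (clique refl refl v≢sv)
    nb-adjacent 1F = inj₁ (clique refl refl v≢ssv)
    nb-adjacent 2F = inj₁ (column refl refl)
    nb-adjacent 3F = inj₂ (twist refl refl (inj₁ refl))
    nb-adjacent 4F = inj₂ (twist refl refl (inj₂ (sym (succ-pred v))))

  upper-degree : ∀ {k} x → layer x ≡ suc k → ¬ HasDistinctNeighbours 5 x
  upper-degree {k} x x∈layer = labelled-neighbours x (slot ∘ neighbour-of-upper x∈layer) same-slot
    where
    candidate : Fin 4 → Fin N × ℕ
    candidate 0F = proj₁ x , k
    candidate 1F = proj₁ x , 2 + k
    candidate 2F = proj₁ x , 0
    candidate 3F = succ (proj₁ x) , 0
    slot : ∀ {w j} → UpperNeighbour (proj₁ x) k w j → Fin 4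
    slot (below _ _)         = 0F
    slot (above _ _)         = 1F
    slot (base _ _ (inj₁ _)) = 2F
    slot (base _ _ (inj₂ _)) = 3F
    at-slot : ∀ {w j} (p : UpperNeighbour (proj₁ x) k w j) → (w , j) ≡ candidate (slot p)
    at-slot (below refl refl)         = refl
    at-slot (above refl refl)         = refl
    at-slot (base _ refl (inj₁ refl)) = refl
    at-slot (base _ refl (inj₂ refl)) = refl
    same-slot : ∀ {y z} (p : Adj x y) (q : Adj x z) →
      slot (neighbour-of-upper x∈layer p) ≡ slot (neighbour-of-upper x∈layer q) → y ≡ z
    same-slot p q same = vertex-≡ (cong proj₁ y≡z) (cong proj₂ y≡z)
      where
      y≡z = trans (at-slot (neighbour-of-upper x∈layer p))
              (trans (cong candidate same) (sym (at-slot (neighbour-of-upper x∈layer q))))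

  Base : V → Set
  Base x = layer x ≡ 0

  base⇔five-neighbours : ∀ x → Base x ⇔ HasDistinctNeighbours 5 x
  base⇔five-neighbours (v , 0F)    = mk⇔ (λ _ → base-degree v) (λ _ → refl)
  base⇔five-neighbours (v , suc i) = mk⇔ (λ ()) (⊥-elim ∘ upper-degree (v , suc i) refl)

  base-invariant : Invariant Base
  base-invariant = invariant-⇔ base⇔five-neighbours (distinct-neighbours-invariant 5)

  Twisted : V → Set
  Twisted x = layer x ≡ 2

  twisted⇔attached : ∀ x → Twisted x ⇔ AttachedTwiceTo Base x
  twisted⇔attached (v , i) = mk⇔ attached (twisted i)
    where
    attached : toℕ i ≡ 2 → AttachedTwiceTo Base (v , i)
    attached i≡2 = (λ i≡0 → 0≢1+n (trans (sym i≡0) i≡2)) ,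
      (v , 0F) , (succ v , 0F) , succ-no-fixpoint v ∘ sym ∘ cong proj₁ , refl , refl ,
      inj₁ (twist i≡2 refl (inj₁ refl)) , inj₁ (twist i≡2 refl (inj₂ refl))
    two-base-neighbours : ∀ {k w w′} → UpperNeighbour v k w 0 → UpperNeighbour v k w′ 0 → w ≢ w′ → k ≡ 1
    two-base-neighbours (base k≡1 _ _) _ _ = k≡1
    two-base-neighbours _ (base k≡1 _ _) _ = k≡1
    two-base-neighbours (below w≡v _) (below w′≡v _) w≢w′ = ⊥-elim (w≢w′ (trans w≡v (sym w′≡v)))
    two-base-neighbours (above _ ()) _ _
    two-base-neighbours _ (above _ ()) _
    twisted : ∀ i → AttachedTwiceTo Base (v , i) → toℕ i ≡ 2
    twisted 0F      (i≢0 , _) = ⊥-elim (i≢0 refl)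
    twisted (suc j) (_ , y , z , y≢z , y∈base , z∈base , x~y , x~z) = cong suc (two-base-neighbours
          (subst (UpperNeighbour v (toℕ j) (proj₁ y)) y∈base (neighbour-of-upper {v , suc j} refl x~y))
          (subst (UpperNeighbour v (toℕ j) (proj₁ z)) z∈base (neighbour-of-upper {v , suc j} refl x~z))
          (λ same → y≢z (vertex-≡ same (trans y∈base (sym z∈base)))))

  twisted-invariant : Invariant Twisted
  twisted-invariant = invariant-⇔ twisted⇔attached (attached-invariant base-invariant)

  neighbour-of-base : ∀ {u y} → Adj (u , 0F) y → ¬ Base y → ¬ Twisted y → proj₁ y ≡ u × layer y ≡ 1
  neighbour-of-base {y = w , 0F}    _   y∉base _ = ⊥-elim (y∉base refl)
  neighbour-of-base {y = w , suc j} adj y∉base y∉twisted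
    with neighbour-of-upper {w , suc j} refl (Data.Sum.swap adj)
  ... | below u≡w 0≡j = sym u≡w , cong suc (sym 0≡j)
  ... | above _ ()
  ... | base j≡1 _ _  = ⊥-elim (y∉twisted (cong suc j≡1))

  neighbour-in-column : ∀ {x y k} → layer x ≡ suc k → Adj x y → ¬ Base y →
                        proj₁ y ≡ proj₁ x × (layer y ≡ k ⊎ layer y ≡ 2 + k)
  neighbour-in-column x∈1+k adj y∉base with neighbour-of-upper x∈1+k adj
  ... | below w≡u j≡k   = w≡u , inj₁ j≡k
  ... | above w≡u j≡2+k = w≡u , inj₂ j≡2+k
  ... | base _ j≡0 _    = ⊥-elim (y∉base j≡0)

  neighbour-of-twisted : ∀ {u w} → Adj (u , 2F) (w , 0F) → w ≡ u ⊎ w ≡ succ u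
  neighbour-of-twisted {u} adj with neighbour-of-upper {u , 2F} refl adj
  ... | below _ ()
  ... | above _ ()
  ... | base _ _ w≡ = w≡

  -- Writing g v for the column of
  -- σ (v , 0), layer 0 is mapped to itself, and then layer by layer each
  -- column v is carried to column g v, because (v , 1 + k) is the only
  -- neighbour of (v , k) outside layers 0, k - 1 (and 2, when k = 0).
  -- Finally the twist edges force g to commute with succ.
  module AutomorphismIsRotation (σ : V ↔ V) (aut : IsAutomorphism σ) where

    g : Fin N → Fin N
    g v = proj₁ (to σ (v , 0F))

    OnLayer : ℕ → Set
    OnLayer k = ∀ v (i : Fin R) → toℕ i ≡ k → to σ (v , i) ≡ (g v , i)

    σ-adj-at : ∀ {x y x′ y′} → to σ x ≡ x′ → to σ y ≡ y′ → Adj x y → Adj x′ y′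
    σ-adj-at {x} {y} refl refl = Equivalence.to (aut x y)

    σ-not-base : ∀ {x} → layer x ≢ 0 → ¬ Base (to σ x)
    σ-not-base {x} x∉base = x∉base ∘ invariant-reflected base-invariant σ aut x

    on-layer-0 : OnLayer 0
    on-layer-0 v 0F _ = vertex-≡ refl (base-invariant σ aut (v , 0F) refl)

    on-layer-1 : OnLayer 1
    on-layer-1 v i i≡1 = vertex-≡ column≡ (trans layer≡1 (sym i≡1))
      where
      y = to σ (v , i)
      next : proj₁ y ≡ g v × layer y ≡ 1
      next = neighbour-of-base
        (σ-adj-at (on-layer-0 v 0F refl) refl (inj₁ (column i≡1 refl)))
        (σ-not-base (λ i≡0 → 0≢1+n (trans (sym i≡0) i≡1)))
        (λ y∈2 → 1+n≢n (trans (sym (invariant-reflected twisted-invariant σ aut (v , i) y∈2)) i≡1))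
      column≡ = proj₁ next
      layer≡1 = proj₂ next

    on-layer-2+ : ∀ k → OnLayer k → OnLayer (1 + k) → OnLayer (2 + k)
    on-layer-2+ k on-k on-1+k v i i≡2+k with i⁻ , i⁻≡1+k ← index-below i i≡2+k
      with neighbour-in-column {k = k} i⁻≡1+k
             (σ-adj-at (on-1+k v i⁻ i⁻≡1+k) refl (inj₁ (column (trans i≡2+k (cong suc (sym i⁻≡1+k))) refl)))
             (σ-not-base {v , i} (λ i≡0 → 0≢1+n (trans (sym i≡0) i≡2+k)))
    ... | column≡ , inj₂ layer≡2+k = vertex-≡ column≡ (trans layer≡2+k (sym i≡2+k))
    ... | column≡ , inj₁ layer≡k   = ⊥-elim (m≢1+n+m k (trans (sym layer≡k) (trans j≡i i≡2+k)))
      where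
      j = proj₂ (to σ (v , i))
      -- otherwise σ would identify (v , i) with the lower vertex (v , j)
      j≡i : toℕ j ≡ toℕ i
      j≡i = cong (toℕ ∘ proj₂) (to-injective σ (trans (on-k v j layer≡k) (sym (vertex-≡ column≡ refl))))

    on-every-layer : ∀ k → OnLayer k × OnLayer (suc k)
    on-every-layer zero    = on-layer-0 , on-layer-1
    on-every-layer (suc k) = let on-k , on-1+k = on-every-layer k in on-1+k , on-layer-2+ k on-k on-1+k

    g-succ : ∀ v → g (succ v) ≡ succ (g v)
    g-succ v with neighbour-of-twisted
      (σ-adj-at {v , 2F} {succ v , 0F}
                (proj₁ (on-every-layer 2) v 2F refl) (on-layer-0 (succ v) 0F refl)
                (inj₁ (twist refl refl (inj₂ refl))))
    ... | inj₂ g-sv≡s-gv = g-sv≡s-gv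
    ... | inj₁ g-sv≡gv   = ⊥-elim (succ-no-fixpoint v (cong proj₁ (to-injective σ
          (trans (on-layer-0 (succ v) 0F refl) (trans (cong (_, 0F) g-sv≡gv) (sym (on-layer-0 v 0F refl)))))))

    is-rotation : ∀ x → to σ x ≡ parallelAct (g 0F) x
    is-rotation (v , i) =
      trans (proj₁ (on-every-layer (toℕ i)) v i refl) (cong (_, i) (commutes-with-succ⇒rot g g-succ v))

  automorphism⇔rotation : ∀ σ → IsAutomorphism σ ⇔ ∃ λ k → ∀ x → to σ x ≡ parallelAct k x
  automorphism⇔rotation σ = mk⇔
    (λ aut → let open AutomorphismIsRotation σ aut in g 0F , is-rotation)
    (λ (k , σ≗k) x y → subst₂ (λ a b → Adj x y ⇔ Adj a b) (sym (σ≗k x)) (sym (σ≗k y))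
                         (rotation-automorphism k x y))

lemma3p7 : ∀ (r n : ℕ) → 3 ≤ r → 3 ≤ n →
    Σ ℕ λ m → Σ (ColoredGraph 2 (Fin m)) λ G → Σ (Fin m ↔ (Fin n × Fin r)) λ f →
      ∀ (π : Permutation′ m) →
        IsAut G π ⇔ ∃ λ (k : Fin n) → ∀ x → Inverse.to f (π ⟨$⟩ʳ x) ≡ parallelAct k (Inverse.to f x)
lemma3p7 (suc (suc (suc b))) (suc (suc (suc a))) (s≤s (s≤s (s≤s _))) (s≤s (s≤s (s≤s _))) =
  _ , colouring f , f , λ π → begin
    IsAut (colouring f) π                                      ∼⟨ isAut⇔isAutomorphism f π ⟩
    IsAutomorphism (conjugate f π)                             ∼⟨ automorphism⇔rotation (conjugate f π) ⟩
    (∃ λ k → ∀ x → to (conjugate f π) x ≡ parallelAct k x)    ∼⟨ Σ.cong (↔-id _) (conjugate-≗ f π (parallelAct _)) ⟩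
    (∃ λ k → ∀ i → to f (π ⟨$⟩ʳ i) ≡ parallelAct k (to f i))  ∎
  where
  open Construction a b
  open Automorphisms Γ
  open EquationalReasoning
  f : Fin (suc (suc (suc a)) * R) ↔ V
  f = *↔×
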